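{- $E_{\mathbb Z_3',\{1\}}(3)=5$.
   Context: $\mathbb Z_3=\mathbb Z/3\mathbb Z$ as a module over itself and $\mathbb Z_3'=\mathbb Z_3\setminus\{0\}$. A subsequence is a non-empty subfamily of terms in the original order. For non-empty $A,B\subseteq\mathbb Z_n$, a sequence $(x_1,\ldots,x_k)$ is an $(A,B)$-weighted zero-sum sequence if there exist $a_i\in A$, $b_i\in B$ with $\sum a_ix_i=0$ and $\sum b_ia_i=0$. $E_{A,B}(n)$ is the least positive $k$ such that every sequence in $\mathbb Z_n$ of length $k$ has an $(A,B)$-weighted zero-sum subsequence of length $n$. -}

module Defs where

open import Data.Nat using (ℕ; zero; suc; _+_; _*_; _%_; _≤_; _<_; NonZero)
open import Data.Fin using (Fin; toℕ) renaming (zero to fzero; suc to fsuc; _<_ to _<ᶠ_)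
open import Data.Product using (Σ; _×_; ∃)
open import Relation.Binary.PropositionalEquality using (_≡_; _≢_)
open import Relation.Nullary using (¬_)

-- Z_n is represented by Fin n (residues 0..n-1); arithmetic is done on the
-- natural-number representatives and reduced mod n.

∑ : {m : ℕ} → (Fin m → ℕ) → ℕ
∑ {zero}  f = 0
∑ {suc m} f = f fzero + ∑ (λ i → f (fsuc i))

IsZeroMod : (n : ℕ) .{{_ : NonZero n}} → ℕ → Set
IsZeroMod n s = s % n ≡ 0

WeightedZeroSum : (n : ℕ) .{{_ : NonZero n}} → (A B : Fin n → Set) →
                  {m : ℕ} → (Fin m → Fin n) → Set
WeightedZeroSum n A B {m} x =
  Σ (Fin m → Fin n) λ a → (∀ i → A (a i)) ×
  Σ (Fin m → Fin n) λ b → (∀ i → B (b i)) ×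
  IsZeroMod n (∑ (λ i → toℕ (a i) * toℕ (x i))) ×
  IsZeroMod n (∑ (λ i → toℕ (b i) * toℕ (a i)))

-- subsequence of length l of x : Fin k → Z_n, given by a strictly increasing
-- choice of indices σ : Fin l → Fin k
StrictlyIncreasing : {l k : ℕ} → (Fin l → Fin k) → Set
StrictlyIncreasing σ = ∀ i j → i <ᶠ j → σ i <ᶠ σ j

HasWZSSubseqOfLength : (n : ℕ) .{{_ : NonZero n}} → (A B : Fin n → Set) →
                       {k : ℕ} → (Fin k → Fin n) → Set
HasWZSSubseqOfLength n A B {k} x =
  Σ (Fin n → Fin k) λ σ → StrictlyIncreasing σ ×
    WeightedZeroSum n A B (λ i → x (σ i))

EProperty : (n : ℕ) .{{_ : NonZero n}} → (A B : Fin n → Set) → ℕ → Set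
EProperty n A B k = (x : Fin k → Fin n) → HasWZSSubseqOfLength n A B x

IsE : (n : ℕ) .{{_ : NonZero n}} → (A B : Fin n → Set) → ℕ → Set
IsE n A B e = (1 ≤ e) × EProperty n A B e ×
              (∀ k → 1 ≤ k → k < e → ¬ EProperty n A B k)

Z3' : Fin 3 → Set
Z3' a = a ≢ fzero

One3 : Fin 3 → Set
One3 b = b ≡ fsuc fzero

-- With b = 1 the weights a_i ∈ {1, 2} of a length-3 sequence must themselves
-- sum to 0 mod 3, which forces them to be equal; a common unit weight can be
-- cancelled, so a (ℤ₃', {1})-weighted zero-sum sequence of length 3 is just a
-- zero-sum sequence.  The theorem is therefore the Erdős–Ginzburg–Ziv theorem
-- for n = 3: every 5 elements of ℤ₃ contain 3 (in order) with sum 0, checked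
-- exhaustively, while (0, 0, 1, 1) contains no such 3.
module Submission where

open import Defs
open import Data.Nat using (ℕ; zero; suc; NonZero; _+_; _*_; _%_; _≤_; _<_; _≤′_; ≤′-reflexive; ≤′-step; z≤n; s≤s; s≤s⁻¹)
open import Data.Nat.Properties using (_≟_; *-identityˡ; *-zeroʳ; *-comm; *-assoc; *-distribˡ-+; <-trans; ≤⇒≤′)
open import Data.Nat.DivMod using (%-distribˡ-*; m%n%n≡m%n; m*n%n≡0)
open import Data.Fin using (Fin; toℕ; inject₁; finToFun; funToFin) renaming (zero to fzero; suc to fsuc; _<_ to _<ᶠ_)
open import Data.Fin.Properties using (toℕ-inject₁; finToFun-funToFin; all?; any?; _<?_)
open import Data.Vec.Functional using ([]; _∷_)
open import Data.Product using (Σ; ∃; _×_; _,_)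
open import Data.Empty using (⊥-elim)
open import Function using (id; _∘_; const)
open import Relation.Binary.PropositionalEquality using (_≡_; _≢_; _≗_; refl; sym; trans; cong; cong₂; subst; module ≡-Reasoning)
open import Relation.Nullary using (¬_; Dec; map′)
open import Relation.Nullary.Decidable using (_×-dec_; from-yes; from-no)

private
  variable
    k l m : ℕ

∑-cong : {f g : Fin m → ℕ} → f ≗ g → ∑ f ≡ ∑ g
∑-cong {zero}  f≗g = refl
∑-cong {suc m} f≗g = cong₂ _+_ (f≗g fzero) (∑-cong (f≗g ∘ fsuc))

*-distribˡ-∑ : ∀ c (f : Fin m → ℕ) → c * ∑ f ≡ ∑ (λ i → c * f i)
*-distribˡ-∑ {zero}  c f = *-zeroʳ c
*-distribˡ-∑ {suc m} c f =
  trans (*-distribˡ-+ c (f fzero) _) (cong (c * f fzero +_) (*-distribˡ-∑ c (f ∘ fsuc)))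

∑-const : ∀ m c → ∑ {m} (const c) ≡ m * c
∑-const zero    c = refl
∑-const (suc m) c = cong (c +_) (∑-const m c)

zeroMod-cancelˡ : ∀ n .{{_ : NonZero n}} c d s →
                  (d * c) % n ≡ 1 → (c * s) % n ≡ 0 → s % n ≡ 0
zeroMod-cancelˡ n@(suc _) c d s dc≡1 cs≡0 = begin
  s % n                         ≡⟨ sym (m%n%n≡m%n s n) ⟩
  s % n % n                     ≡⟨ cong (_% n) (sym (*-identityˡ (s % n))) ⟩
  (1 * (s % n)) % n             ≡⟨ cong (λ t → (t * (s % n)) % n) (sym dc≡1) ⟩
  ((d * c) % n * (s % n)) % n   ≡⟨ sym (%-distribˡ-* (d * c) s n) ⟩
  (d * c * s) % n               ≡⟨ cong (_% n) (*-assoc d c s) ⟩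
  (d * (c * s)) % n             ≡⟨ %-distribˡ-* d (c * s) n ⟩
  (d % n * ((c * s) % n)) % n   ≡⟨ cong (λ t → (d % n * t) % n) cs≡0 ⟩
  (d % n * 0) % n               ≡⟨ cong (_% n) (*-zeroʳ (d % n)) ⟩
  0                             ∎
  where open ≡-Reasoning

ZeroSum : (n : ℕ) .{{_ : NonZero n}} → (Fin m → Fin n) → Set
ZeroSum n y = IsZeroMod n (∑ (toℕ ∘ y))

HasZeroSumSubseqOfLength : (n : ℕ) .{{_ : NonZero n}} → (Fin k → Fin n) → Set
HasZeroSumSubseqOfLength {k} n x =
  Σ (Fin n → Fin k) λ σ → StrictlyIncreasing σ × ZeroSum n (x ∘ σ)

zeroSum⇒weightedZeroSum : {A B : Fin (suc (suc m)) → Set} →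
                          A (fsuc fzero) → B (fsuc fzero) →
                          (y : Fin (suc (suc m)) → Fin (suc (suc m))) →
                          ZeroSum (suc (suc m)) y → WeightedZeroSum (suc (suc m)) A B y
zeroSum⇒weightedZeroSum {m} {A} {B} A1 B1 y Σy≡0 =
  const (fsuc fzero) , const A1 , const (fsuc fzero) , const B1 ,
  subst (IsZeroMod n) (trans (sym (*-identityˡ _)) (*-distribˡ-∑ 1 (toℕ ∘ y))) Σy≡0 ,
  subst (IsZeroMod n) (sym (trans (∑-const n 1) (*-comm n 1))) (m*n%n≡0 1 n)
  where n = suc (suc m)

hasZeroSumSubseq⇒hasWZSSubseq : {A B : Fin (suc (suc m)) → Set} →
                                A (fsuc fzero) → B (fsuc fzero) →
                                (x : Fin k → Fin (suc (suc m))) →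
                                HasZeroSumSubseqOfLength (suc (suc m)) x →
                                HasWZSSubseqOfLength (suc (suc m)) A B x
hasZeroSumSubseq⇒hasWZSSubseq {A = A} {B} A1 B1 x (σ , σ↑ , Σxσ≡0) =
  σ , σ↑ , zeroSum⇒weightedZeroSum {A = A} {B} A1 B1 (x ∘ σ) Σxσ≡0

zeroSumUnits₃-equal : {u v w : Fin 3} → u ≢ fzero → v ≢ fzero → w ≢ fzero →
                      (toℕ u + (toℕ v + (toℕ w + 0))) % 3 ≡ 0 → v ≡ u × w ≡ u
zeroSumUnits₃-equal {fzero} u≢0 _ _ _ = ⊥-elim (u≢0 refl)
zeroSumUnits₃-equal {v = fzero} _ v≢0 _ _ = ⊥-elim (v≢0 refl)
zeroSumUnits₃-equal {w = fzero} _ _ w≢0 _ = ⊥-elim (w≢0 refl)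
zeroSumUnits₃-equal {fsuc fzero}        {fsuc fzero}        {fsuc fzero}        _ _ _ _ = refl , refl
zeroSumUnits₃-equal {fsuc (fsuc fzero)} {fsuc (fsuc fzero)} {fsuc (fsuc fzero)} _ _ _ _ = refl , refl
zeroSumUnits₃-equal {fsuc fzero}        {fsuc fzero}        {fsuc (fsuc fzero)} _ _ _ ()
zeroSumUnits₃-equal {fsuc fzero}        {fsuc (fsuc fzero)} {fsuc fzero}        _ _ _ ()
zeroSumUnits₃-equal {fsuc fzero}        {fsuc (fsuc fzero)} {fsuc (fsuc fzero)} _ _ _ ()
zeroSumUnits₃-equal {fsuc (fsuc fzero)} {fsuc fzero}        {fsuc fzero}        _ _ _ ()
zeroSumUnits₃-equal {fsuc (fsuc fzero)} {fsuc fzero}        {fsuc (fsuc fzero)} _ _ _ ()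
zeroSumUnits₃-equal {fsuc (fsuc fzero)} {fsuc (fsuc fzero)} {fsuc fzero}        _ _ _ ()

zeroSumUnits₃-constant : (a : Fin 3 → Fin 3) → (∀ i → a i ≢ fzero) → ZeroSum 3 a →
                         ∀ i → a i ≡ a fzero
zeroSumUnits₃-constant a a≢0 Σa≡0 i
  with a₁≡a₀ , a₂≡a₀ ← zeroSumUnits₃-equal (a≢0 fzero) (a≢0 (fsuc fzero)) (a≢0 (fsuc (fsuc fzero))) Σa≡0
  with i
... | fzero             = refl
... | fsuc fzero        = a₁≡a₀
... | fsuc (fsuc fzero) = a₂≡a₀

unit₃-selfInverse : (c : Fin 3) → c ≢ fzero → (toℕ c * toℕ c) % 3 ≡ 1
unit₃-selfInverse fzero               c≢0 = ⊥-elim (c≢0 refl)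
unit₃-selfInverse (fsuc fzero)        _   = refl
unit₃-selfInverse (fsuc (fsuc fzero)) _   = refl

weightedZeroSum⇒zeroSum₃ : (y : Fin 3 → Fin 3) → WeightedZeroSum 3 Z3' One3 y → ZeroSum 3 y
weightedZeroSum⇒zeroSum₃ y (a , a≢0 , b , b≡1 , Σay≡0 , Σba≡0) =
  zeroMod-cancelˡ 3 (toℕ c) (toℕ c) (∑ (toℕ ∘ y)) (unit₃-selfInverse c (a≢0 fzero)) cΣy≡0
  where
  c = a fzero

  Σa≡0 : ZeroSum 3 a
  Σa≡0 = subst (IsZeroMod 3)
    (∑-cong (λ i → trans (cong (λ u → toℕ u * toℕ (a i)) (b≡1 i)) (*-identityˡ _))) Σba≡0

  cΣy≡0 : (toℕ c * ∑ (toℕ ∘ y)) % 3 ≡ 0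
  cΣy≡0 = subst (IsZeroMod 3)
    (trans (∑-cong (λ i → cong (λ u → toℕ u * toℕ (y i)) (zeroSumUnits₃-constant a a≢0 Σa≡0 i)))
           (sym (*-distribˡ-∑ (toℕ c) (toℕ ∘ y))))
    Σay≡0

hasWZSSubseq⇒hasZeroSumSubseq₃ : (x : Fin k → Fin 3) → HasWZSSubseqOfLength 3 Z3' One3 x →
                                 HasZeroSumSubseqOfLength 3 x
hasWZSSubseq⇒hasZeroSumSubseq₃ x (σ , σ↑ , w) = σ , σ↑ , weightedZeroSum⇒zeroSum₃ (x ∘ σ) w

triple : Fin k → Fin k → Fin k → Fin 3 → Fin k
triple i j l fzero               = i
triple i j l (fsuc fzero)        = j
triple i j l (fsuc (fsuc fzero)) = l

triple-strictlyIncreasing : {i j l : Fin k} → i <ᶠ j → j <ᶠ l → StrictlyIncreasing (triple i j l)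
triple-strictlyIncreasing i<j j<l fzero        (fsuc fzero)        _ = i<j
triple-strictlyIncreasing i<j j<l fzero        (fsuc (fsuc fzero)) _ = <-trans i<j j<l
triple-strictlyIncreasing i<j j<l (fsuc fzero) (fsuc (fsuc fzero)) _ = j<l
triple-strictlyIncreasing _ _ fzero               fzero               ()
triple-strictlyIncreasing _ _ (fsuc fzero)        fzero               ()
triple-strictlyIncreasing _ _ (fsuc fzero)        (fsuc fzero)        (s≤s ())
triple-strictlyIncreasing _ _ (fsuc (fsuc fzero)) fzero               ()
triple-strictlyIncreasing _ _ (fsuc (fsuc fzero)) (fsuc fzero)        (s≤s ())
triple-strictlyIncreasing _ _ (fsuc (fsuc fzero)) (fsuc (fsuc fzero)) (s≤s (s≤s ()))

hasZeroSumSubseq₃? : (x : Fin k → Fin 3) → Dec (HasZeroSumSubseqOfLength 3 x)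
hasZeroSumSubseq₃? x = map′ fromTriple toTriple
  (any? λ i → any? λ j → any? λ l → i <? j ×-dec j <? l ×-dec (_ ≟ 0))
  where
  fromTriple : (∃ λ i → ∃ λ j → ∃ λ l → i <ᶠ j × j <ᶠ l × ZeroSum 3 (x ∘ triple i j l)) →
               HasZeroSumSubseqOfLength 3 x
  fromTriple (i , j , l , i<j , j<l , Σ≡0) = triple i j l , triple-strictlyIncreasing i<j j<l , Σ≡0

  toTriple : HasZeroSumSubseqOfLength 3 x →
             ∃ λ i → ∃ λ j → ∃ λ l → i <ᶠ j × j <ᶠ l × ZeroSum 3 (x ∘ triple i j l)
  toTriple (σ , σ↑ , Σ≡0) =
    σ fzero , σ (fsuc fzero) , σ (fsuc (fsuc fzero)) ,
    σ↑ fzero (fsuc fzero) (s≤s z≤n) , σ↑ (fsuc fzero) (fsuc (fsuc fzero)) (s≤s (s≤s z≤n)) , Σ≡0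

hasZeroSumSubseq-resp-≗ : (n : ℕ) .{{_ : NonZero n}} {x y : Fin k → Fin n} → x ≗ y →
                          HasZeroSumSubseqOfLength n x → HasZeroSumSubseqOfLength n y
hasZeroSumSubseq-resp-≗ n x≗y (σ , σ↑ , Σ≡0) =
  σ , σ↑ , subst (IsZeroMod n) (∑-cong (cong toℕ ∘ x≗y ∘ σ)) Σ≡0

erdősGinzburgZiv₃ : (x : Fin 5 → Fin 3) → HasZeroSumSubseqOfLength 3 x
erdősGinzburgZiv₃ x = hasZeroSumSubseq-resp-≗ 3 (finToFun-funToFin x) (everySequence (funToFin x))
  where
  everySequence : ∀ c → HasZeroSumSubseqOfLength 3 (finToFun {3} {5} c)
  everySequence = from-yes (all? λ c → hasZeroSumSubseq₃? (finToFun {3} {5} c))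

seq₀₀₁₁ : Fin 4 → Fin 3
seq₀₀₁₁ = fzero ∷ fzero ∷ fsuc fzero ∷ fsuc fzero ∷ []

noZeroSumSubseq-seq₀₀₁₁ : ¬ HasZeroSumSubseqOfLength 3 seq₀₀₁₁
noZeroSumSubseq-seq₀₀₁₁ = from-no (hasZeroSumSubseq₃? seq₀₀₁₁)

inject₁-mono-< : {i j : Fin k} → i <ᶠ j → inject₁ i <ᶠ inject₁ j
inject₁-mono-< {i = i} {j} i<j rewrite toℕ-inject₁ i | toℕ-inject₁ j = i<j

module _ {n : ℕ} .{{_ : NonZero n}} {A B : Fin n → Set} where

  EProperty-suc : EProperty n A B k → EProperty n A B (suc k)
  EProperty-suc E x with σ , σ↑ , w ← E (x ∘ inject₁) =
    inject₁ ∘ σ , (λ i j i<j → inject₁-mono-< (σ↑ i j i<j)) , w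

  EProperty-mono : k ≤ l → EProperty n A B k → EProperty n A B l
  EProperty-mono = go ∘ ≤⇒≤′
    where
    go : k ≤′ l → EProperty n A B k → EProperty n A B l
    go (≤′-reflexive refl) = id
    go (≤′-step k≤′l)      = EProperty-suc ∘ go k≤′l

theorem8 : IsE 3 Z3' One3 5
theorem8 = s≤s z≤n , upper , lower
  where
  upper : EProperty 3 Z3' One3 5
  upper x = hasZeroSumSubseq⇒hasWZSSubseq {A = Z3'} {One3} (λ ()) refl x (erdősGinzburgZiv₃ x)

  lower : ∀ k → 1 ≤ k → k < 5 → ¬ EProperty 3 Z3' One3 k
  lower k _ k<5 E = noZeroSumSubseq-seq₀₀₁₁
    (hasWZSSubseq⇒hasZeroSumSubseq₃ seq₀₀₁₁ (EProperty-mono {A = Z3'} {One3} (s≤s⁻¹ k<5) E seq₀₀₁₁))
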